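{- Let $G$ be a finite simple graph. For each vertex $v\in V(G)$ let $G_v$ be the graph with vertex set $(V(G)\setminus\{v\})\cup\{v_1,v_2\}$ (where $v_1,v_2$ are new vertices) and edge set $E(G-v)\cup\{v_1v_2\}\cup\{wv_i : w\in N(v),\ i\in\{1,2\}\}$, where $N(v)$ is the neighborhood of $v$ in $G$. Then for every positive integer $k$, $$\pi_G^{(P_2)}(k) = \frac{1}{2}\sum_{v\in V(G)} \pi_{G_v}(k).$$
   Context: $P_2$ denotes the path on two vertices (a single edge). For a positive integer $k$, a proper $k$-coloring of $G$ is a map $\phi:V(G)\to\{1,\dots,k\}$ with adjacent vertices receiving different colors; $\pi_G(k)$ is the number of proper $k$-colorings of $G$. The $k$-coloring graph $\mathcal{C}_k(G)$ has the proper $k$-colorings of $G$ as vertices, two colorings adjacent iff they differ in the color of exactly one vertex. For a graph $H$, $\pi_G^{(H)}(k)$ is the number of vertex subsets $U$ of $\mathcal{C}_k(G)$ whose induced subgraph is isomorphic to $H$; thus $\pi_G^{(P_2)}(k)$ is the number of edges of $\mathcal{C}_k(G)$. -}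

module Defs where

open import Data.Nat using (ℕ; zero; suc; _+_)
import Data.Nat as ℕ
open import Data.Bool using (Bool; true; false; _∨_; if_then_else_)
open import Data.Fin using (Fin; zero; suc)
open import Data.Fin.Properties using (all?) renaming (_≟_ to _≟ᶠ_)
open import Data.Vec using (Vec; []; _∷_; lookup)
open import Data.List using (List; []; _∷_; [_]; map; concatMap; allFin; filter; length; _++_)
open import Data.Product using (_×_; _,_; proj₁; proj₂)
open import Relation.Binary.PropositionalEquality using (_≡_; _≢_; refl)
open import Relation.Nullary using (Dec; yes; no; ¬?; does)
open import Relation.Nullary.Decidable using (_→-dec_)

record SimpleGraph (n : ℕ) : Set where
  field
    adj   : Fin n → Fin n → Bool
    adj-sym : ∀ i j → adj i j ≡ adj j i
    irrfl : ∀ i → adj i i ≡ false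
open SimpleGraph public

Coloring : ℕ → ℕ → Set
Coloring n k = Vec (Fin k) n

-- complete (duplicate-free) enumeration of all maps Fin n → Fin k
allColorings : (n k : ℕ) → List (Coloring n k)
allColorings zero    k = [ [] ]
allColorings (suc n) k = concatMap (λ c → map (_∷ c) (allFin k)) (allColorings n k)

Proper : ∀ {n k} → SimpleGraph n → Coloring n k → Set
Proper G c = ∀ i j → adj G i j ≡ true → lookup c i ≢ lookup c j

proper? : ∀ {n k} (G : SimpleGraph n) (c : Coloring n k) → Dec (Proper G c)
proper? G c = all? λ i → all? λ j →
  (adj G i j Data.Bool.≟ true) →-dec ¬? (lookup c i ≟ᶠ lookup c j)

properColorings : ∀ {n} → SimpleGraph n → (k : ℕ) → List (Coloring n k)
properColorings {n} G k = filter (proper? G) (allColorings n k)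

π : ∀ {n} → SimpleGraph n → ℕ → ℕ
π G k = length (properColorings G k)

diffCount : ∀ {n k} → Coloring n k → Coloring n k → ℕ
diffCount {n} c d = length (filter (λ i → ¬? (lookup c i ≟ᶠ lookup d i)) (allFin n))

-- adjacency in the k-coloring graph C_k(G): differ at exactly one vertex
CAdj : ∀ {n k} → Coloring n k × Coloring n k → Set
CAdj (c , d) = diffCount c d ≡ 1

CAdj? : ∀ {n k} (p : Coloring n k × Coloring n k) → Dec (CAdj p)
CAdj? (c , d) = diffCount c d ℕ.≟ 1

pairs : ∀ {A : Set} → List A → List (A × A)
pairs []       = []
pairs (x ∷ xs) = map (x ,_) xs ++ pairs xs

-- π_G^{(P_2)}(k): number of 2-subsets of V(C_k(G)) inducing P_2,
-- i.e. the number of edges of C_k(G).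
πP₂ : ∀ {n} → SimpleGraph n → ℕ → ℕ
πP₂ G k = length (filter CAdj? (pairs (properColorings G k)))

-- G_v: vertex set Fin (suc n); vertex 0 is the new vertex v₂,
-- vertex (suc i) is the old vertex i, and (suc v) plays the role of v₁.
-- Edges: old edges among old vertices (incl. v₁ = v with N(v)),
-- v₁v₂, and w v₂ for w ∈ N(v).
splitAdj : ∀ {n} → SimpleGraph n → Fin n → Fin (suc n) → Fin (suc n) → Bool
splitAdj G v zero    zero    = false
splitAdj G v zero    (suc j) = does (j ≟ᶠ v) ∨ adj G v j
splitAdj G v (suc i) zero    = does (i ≟ᶠ v) ∨ adj G v i
splitAdj G v (suc i) (suc j) = adj G i j

splitAdj-sym : ∀ {n} (G : SimpleGraph n) v i j → splitAdj G v i j ≡ splitAdj G v j i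
splitAdj-sym G v zero    zero    = refl
splitAdj-sym G v zero    (suc j) = refl
splitAdj-sym G v (suc i) zero    = refl
splitAdj-sym G v (suc i) (suc j) = adj-sym G i j

splitAdj-irr : ∀ {n} (G : SimpleGraph n) v i → splitAdj G v i i ≡ false
splitAdj-irr G v zero    = refl
splitAdj-irr G v (suc i) = irrfl G i

split : ∀ {n} → SimpleGraph n → Fin n → SimpleGraph (suc n)
split G v = record { adj = splitAdj G v ; adj-sym = splitAdj-sym G v ; irrfl = splitAdj-irr G v }

{-# OPTIONS --safe #-}
-- Counting the edges of C_k(G) by degrees gives 2|E| = Σ_c deg c over proper colourings c, and
-- deg c is the number of pairs (v, a) with a ≠ c(v) such that recolouring v by a stays proper.
-- For fixed v such pairs (c, a) are exactly the proper colourings of G_v: c colours the old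
-- vertices (v₁ = v among them) and a colours v₂, whose edges to v₁ and to N(v) demand precisely
-- a ≠ c(v) and that c with v recoloured by a is proper.  Summing over v gives the identity.
module Submission where

open import Defs
open import Data.Bool using (true; false; _∨_; if_then_else_)
open import Data.Bool.Properties using (∨-zeroʳ)
open import Data.Fin using (Fin; zero; suc)
open import Data.Fin.Properties using (suc-injective) renaming (_≟_ to _≟ᶠ_)
open import Data.List using (List; []; _∷_; _++_; map; concatMap; filter; length; allFin)
open import Data.List.Properties using (map-++; map-∘; map-cong; map-tabulate)
open import Data.Nat using (ℕ; suc; _+_; _*_; _≤_; _≟_)
open import Data.Nat.ListAction using (sum)
open import Data.Nat.ListAction.Properties using (sum-++)
open import Data.Nat.Properties
  using (+-identityʳ; *-comm; *-assoc; *-zeroʳ; *-distribˡ-+; +-commutativeSemigroup)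
open import Algebra.Properties.CommutativeSemigroup +-commutativeSemigroup
  renaming (interchange to +-interchange)
open import Data.Nat.Solver using (module +-*-Solver)
open import Data.Product using (_×_; _,_; uncurry)
open import Data.Vec using ([]; _∷_; lookup; _[_]≔_)
open import Data.Vec.Properties using (lookup∘update; lookup∘update′)
open import Function using (_∘_; _$_; id)
open import Function.Bundles using (_⇔_; mk⇔)
open import Relation.Nullary using (Dec; yes; no; does; ¬_; ¬?; _×-dec_; contradiction)
open import Relation.Nullary.Decidable using (does-⇔; dec-true; dec-false)
open import Relation.Binary.PropositionalEquality
  using (_≡_; _≢_; refl; sym; trans; cong; cong₂; subst₂; module ≡-Reasoning)

𝟙 : {P : Set} → Dec P → ℕ
𝟙 P? = if does P? then 1 else 0

module _ {P Q : Set} where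

  𝟙-⇔ : P ⇔ Q → (P? : Dec P) (Q? : Dec Q) → 𝟙 P? ≡ 𝟙 Q?
  𝟙-⇔ P⇔Q P? Q? = cong (λ b → if b then 1 else 0) (does-⇔ P⇔Q P? Q?)

  𝟙-×-dec : (P? : Dec P) (Q? : Dec Q) → 𝟙 (P? ×-dec Q?) ≡ 𝟙 P? * 𝟙 Q?
  𝟙-×-dec (yes _) (yes _) = refl
  𝟙-×-dec (yes _) (no _)  = refl
  𝟙-×-dec (no _)  _       = refl

𝟙-no : {P : Set} (P? : Dec P) → ¬ P → 𝟙 P? ≡ 0
𝟙-no P? ¬p = cong (λ b → if b then 1 else 0) (dec-false P? ¬p)

∑ : {A : Set} → List A → (A → ℕ) → ℕ
∑ xs f = sum (map f xs)

infix 5 ∑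
syntax ∑ xs (λ x → e) = ∑[ x ∈ xs ] e

module _ {A : Set} where

  ∑-cong : (xs : List A) {f g : A → ℕ} → (∀ x → f x ≡ g x) → ∑ xs f ≡ ∑ xs g
  ∑-cong xs f≗g = cong sum (map-cong f≗g xs)

  ∑-++ : (xs ys : List A) (f : A → ℕ) → ∑ (xs ++ ys) f ≡ ∑ xs f + ∑ ys f
  ∑-++ xs ys f = trans (cong sum (map-++ f xs ys)) (sum-++ (map f xs) (map f ys))

  ∑-zero : (xs : List A) → (∑[ x ∈ xs ] 0) ≡ 0
  ∑-zero []       = refl
  ∑-zero (x ∷ xs) = ∑-zero xs

  ∑-distrib-+ : (xs : List A) (f g : A → ℕ) → (∑[ x ∈ xs ] f x + g x) ≡ ∑ xs f + ∑ xs g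
  ∑-distrib-+ []       f g = refl
  ∑-distrib-+ (x ∷ xs) f g = trans (cong (f x + g x +_) (∑-distrib-+ xs f g))
                                   (+-interchange (f x) (g x) (∑ xs f) (∑ xs g))

  *-distribˡ-∑ : (k : ℕ) (xs : List A) (f : A → ℕ) →
                 k * ∑ xs f ≡ (∑[ x ∈ xs ] k * f x)
  *-distribˡ-∑ k []       f = *-zeroʳ k
  *-distribˡ-∑ k (x ∷ xs) f = trans (*-distribˡ-+ k (f x) (∑ xs f))
                                    (cong (k * f x +_) (*-distribˡ-∑ k xs f))

  length-filter≡∑𝟙 : {P : A → Set} (P? : ∀ x → Dec (P x)) (xs : List A) →
                     length (filter P? xs) ≡ (∑[ x ∈ xs ] 𝟙 (P? x))
  length-filter≡∑𝟙 P? []       = refl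
  length-filter≡∑𝟙 P? (x ∷ xs) with does (P? x)
  ... | true  = cong suc (length-filter≡∑𝟙 P? xs)
  ... | false = length-filter≡∑𝟙 P? xs

  ∑-filter : {P : A → Set} (P? : ∀ x → Dec (P x)) (xs : List A) (f : A → ℕ) →
             ∑ (filter P? xs) f ≡ (∑[ x ∈ xs ] 𝟙 (P? x) * f x)
  ∑-filter P? []       f = refl
  ∑-filter P? (x ∷ xs) f with does (P? x)
  ... | true  = cong₂ _+_ (sym (+-identityʳ (f x))) (∑-filter P? xs f)
  ... | false = ∑-filter P? xs f

module _ {A B : Set} where

  ∑-map : (h : A → B) (xs : List A) (f : B → ℕ) → ∑ (map h xs) f ≡ ∑ xs (f ∘ h)
  ∑-map h xs f = cong sum (sym (map-∘ xs))

  ∑-concatMap : (g : A → List B) (xs : List A) (f : B → ℕ) →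
                ∑ (concatMap g xs) f ≡ (∑[ x ∈ xs ] ∑ (g x) f)
  ∑-concatMap g []       f = refl
  ∑-concatMap g (x ∷ xs) f = trans (∑-++ (g x) (concatMap g xs) f)
                                   (cong (∑ (g x) f +_) (∑-concatMap g xs f))

  ∑-comm : (xs : List A) (ys : List B) (f : A → B → ℕ) →
           (∑[ x ∈ xs ] ∑[ y ∈ ys ] f x y) ≡ (∑[ y ∈ ys ] ∑[ x ∈ xs ] f x y)
  ∑-comm []       ys f = sym (∑-zero ys)
  ∑-comm (x ∷ xs) ys f = trans (cong (∑ ys (f x) +_) (∑-comm xs ys f))
                               (sym (∑-distrib-+ ys (f x) (λ y → ∑[ x ∈ xs ] f x y)))

∑-allFin-suc : ∀ {n} (f : Fin (suc n) → ℕ) →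
               ∑ (allFin (suc n)) f ≡ f zero + ∑ (allFin n) (f ∘ suc)
∑-allFin-suc f = cong (λ ys → f zero + sum ys)
  (trans (map-tabulate suc f) (sym (map-tabulate id (f ∘ suc))))

𝟙-suc≟suc : ∀ {k} (x y : Fin k) → 𝟙 (suc x ≟ᶠ suc y) ≡ 𝟙 (x ≟ᶠ y)
𝟙-suc≟suc x y = 𝟙-⇔ (mk⇔ suc-injective (cong suc)) (suc x ≟ᶠ suc y) (x ≟ᶠ y)

𝟙-¬≟-sym : ∀ {k} (x y : Fin k) → 𝟙 (¬? (x ≟ᶠ y)) ≡ 𝟙 (¬? (y ≟ᶠ x))
𝟙-¬≟-sym x y = 𝟙-⇔ (mk⇔ (_∘ sym) (_∘ sym)) (¬? (x ≟ᶠ y)) (¬? (y ≟ᶠ x))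

∑-allFin-δ : ∀ {k} (x : Fin k) (f : Fin k → ℕ) → (∑[ a ∈ allFin k ] 𝟙 (x ≟ᶠ a) * f a) ≡ f x
∑-allFin-δ {suc k} zero f = begin
  ∑[ a ∈ allFin (suc k) ] 𝟙 (zero ≟ᶠ a) * f a
    ≡⟨ ∑-allFin-suc (λ a → 𝟙 (zero ≟ᶠ a) * f a) ⟩
  f zero + 0 + (∑[ a ∈ allFin k ] 0)
    ≡⟨ cong₂ _+_ (+-identityʳ (f zero)) (∑-zero (allFin k)) ⟩
  f zero + 0
    ≡⟨ +-identityʳ (f zero) ⟩
  f zero ∎
  where open ≡-Reasoning
∑-allFin-δ {suc k} (suc x) f = begin
  ∑[ a ∈ allFin (suc k) ] 𝟙 (suc x ≟ᶠ a) * f a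
    ≡⟨ ∑-allFin-suc (λ a → 𝟙 (suc x ≟ᶠ a) * f a) ⟩
  ∑[ a ∈ allFin k ] 𝟙 (suc x ≟ᶠ suc a) * f (suc a)
    ≡⟨ ∑-cong (allFin k) (λ a → cong (_* f (suc a)) (𝟙-suc≟suc x a)) ⟩
  ∑[ a ∈ allFin k ] 𝟙 (x ≟ᶠ a) * f (suc a)
    ≡⟨ ∑-allFin-δ x (f ∘ suc) ⟩
  f (suc x) ∎
  where open ≡-Reasoning

∑-allColorings-suc : ∀ {m k} (f : Coloring (suc m) k → ℕ) →
  ∑ (allColorings (suc m) k) f ≡ (∑[ c ∈ allColorings m k ] ∑[ a ∈ allFin k ] f (a ∷ c))
∑-allColorings-suc {m} {k} f =
  trans (∑-concatMap (λ c → map (_∷ c) (allFin k)) (allColorings m k) f)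
        (∑-cong (allColorings m k) (λ c → ∑-map (_∷ c) (allFin k) f))

diffCount≡∑ : ∀ {n k} (c d : Coloring n k) →
              diffCount c d ≡ (∑[ i ∈ allFin n ] 𝟙 (¬? (lookup c i ≟ᶠ lookup d i)))
diffCount≡∑ {n} c d = length-filter≡∑𝟙 (λ i → ¬? (lookup c i ≟ᶠ lookup d i)) (allFin n)

module _ {n k : ℕ} where

  diffCount-sym : (c d : Coloring n k) → diffCount c d ≡ diffCount d c
  diffCount-sym c d = begin
    diffCount c d
      ≡⟨ diffCount≡∑ c d ⟩
    ∑[ i ∈ allFin n ] 𝟙 (¬? (lookup c i ≟ᶠ lookup d i))
      ≡⟨ ∑-cong (allFin n) (λ i → 𝟙-¬≟-sym (lookup c i) (lookup d i)) ⟩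
    ∑[ i ∈ allFin n ] 𝟙 (¬? (lookup d i ≟ᶠ lookup c i))
      ≡⟨ diffCount≡∑ d c ⟨
    diffCount d c ∎
    where open ≡-Reasoning

  diffCount-self : (c : Coloring n k) → diffCount c c ≡ 0
  diffCount-self c = begin
    diffCount c c
      ≡⟨ diffCount≡∑ c c ⟩
    ∑[ i ∈ allFin n ] 𝟙 (¬? (lookup c i ≟ᶠ lookup c i))
      ≡⟨ ∑-cong (allFin n) (λ i → 𝟙-no (¬? (lookup c i ≟ᶠ lookup c i)) (_$ refl)) ⟩
    ∑[ i ∈ allFin n ] 0
      ≡⟨ ∑-zero (allFin n) ⟩
    0 ∎
    where open ≡-Reasoning

  module _ (x a : Fin k) (c d : Coloring n k) where

    diffCount-∷ : diffCount (x ∷ c) (a ∷ d) ≡ 𝟙 (¬? (x ≟ᶠ a)) + diffCount c d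
    diffCount-∷ = begin
      diffCount (x ∷ c) (a ∷ d)
        ≡⟨ diffCount≡∑ (x ∷ c) (a ∷ d) ⟩
      ∑ (allFin (suc n)) differ
        ≡⟨ ∑-allFin-suc differ ⟩
      𝟙 (¬? (x ≟ᶠ a)) + ∑ (allFin n) (differ ∘ suc)
        ≡⟨ cong (𝟙 (¬? (x ≟ᶠ a)) +_) (diffCount≡∑ c d) ⟨
      𝟙 (¬? (x ≟ᶠ a)) + diffCount c d ∎
      where
      open ≡-Reasoning
      differ : Fin (suc n) → ℕ
      differ i = 𝟙 (¬? (lookup (x ∷ c) i ≟ᶠ lookup (a ∷ d) i))

    𝟙-diffCount-∷≡0 : 𝟙 (diffCount (x ∷ c) (a ∷ d) ≟ 0) ≡
                      𝟙 (x ≟ᶠ a) * 𝟙 (diffCount c d ≟ 0)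
    𝟙-diffCount-∷≡0 rewrite diffCount-∷ with x ≟ᶠ a
    ... | yes _ = sym (+-identityʳ _)
    ... | no _  = refl

    𝟙-diffCount-∷≡1 : 𝟙 (diffCount (x ∷ c) (a ∷ d) ≟ 1) ≡
                      𝟙 (¬? (x ≟ᶠ a)) * 𝟙 (diffCount c d ≟ 0) +
                      𝟙 (x ≟ᶠ a) * 𝟙 (diffCount c d ≟ 1)
    𝟙-diffCount-∷≡1 rewrite diffCount-∷ with x ≟ᶠ a
    ... | yes _ = sym (+-identityʳ _)
    -- `suc m ≟ 1` computes to `m ≟ 0`, as both are decided by `_≡ᵇ_`.
    ... | no _  = sym (trans (+-identityʳ _) (+-identityʳ _))

∑-diffCount≡0 : ∀ {m k} (c : Coloring m k) (F : Coloring m k → ℕ) →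
                (∑[ d ∈ allColorings m k ] 𝟙 (diffCount c d ≟ 0) * F d) ≡ F c
∑-diffCount≡0 []                F = trans (+-identityʳ _) (+-identityʳ (F []))
∑-diffCount≡0 {suc m} {k} (x ∷ c) F = begin
  ∑[ d ∈ allColorings (suc m) k ] 𝟙 (diffCount (x ∷ c) d ≟ 0) * F d
    ≡⟨ ∑-allColorings-suc (λ d → 𝟙 (diffCount (x ∷ c) d ≟ 0) * F d) ⟩
  ∑[ e ∈ allColorings m k ] ∑[ a ∈ allFin k ] 𝟙 (diffCount (x ∷ c) (a ∷ e) ≟ 0) * F (a ∷ e)
    ≡⟨ ∑-cong (allColorings m k) (λ e → ∑-cong (allFin k) (factor e)) ⟩
  ∑[ e ∈ allColorings m k ] ∑[ a ∈ allFin k ] δ₀ e * (𝟙 (x ≟ᶠ a) * F (a ∷ e))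
    ≡⟨ ∑-cong (allColorings m k) (λ e → *-distribˡ-∑ (δ₀ e) (allFin k) _) ⟨
  ∑[ e ∈ allColorings m k ] δ₀ e * (∑[ a ∈ allFin k ] 𝟙 (x ≟ᶠ a) * F (a ∷ e))
    ≡⟨ ∑-cong (allColorings m k) (λ e → cong (δ₀ e *_) (∑-allFin-δ x (λ a → F (a ∷ e)))) ⟩
  ∑[ e ∈ allColorings m k ] δ₀ e * F (x ∷ e)
    ≡⟨ ∑-diffCount≡0 c (λ e → F (x ∷ e)) ⟩
  F (x ∷ c) ∎
  where
  open ≡-Reasoning
  δ₀ : Coloring m k → ℕ
  δ₀ e = 𝟙 (diffCount c e ≟ 0)

  factor : ∀ e a → 𝟙 (diffCount (x ∷ c) (a ∷ e) ≟ 0) * F (a ∷ e) ≡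
                   δ₀ e * (𝟙 (x ≟ᶠ a) * F (a ∷ e))
  factor e a = begin
    𝟙 (diffCount (x ∷ c) (a ∷ e) ≟ 0) * F (a ∷ e)
      ≡⟨ cong (_* F (a ∷ e)) (𝟙-diffCount-∷≡0 x a c e) ⟩
    𝟙 (x ≟ᶠ a) * δ₀ e * F (a ∷ e)
      ≡⟨ cong (_* F (a ∷ e)) (*-comm (𝟙 (x ≟ᶠ a)) (δ₀ e)) ⟩
    δ₀ e * 𝟙 (x ≟ᶠ a) * F (a ∷ e)
      ≡⟨ *-assoc (δ₀ e) (𝟙 (x ≟ᶠ a)) (F (a ∷ e)) ⟩
    δ₀ e * (𝟙 (x ≟ᶠ a) * F (a ∷ e)) ∎

recolorSum : ∀ {m k} → (Coloring m k → ℕ) → Coloring m k → Fin m → ℕ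
recolorSum {k = k} F c v = ∑[ a ∈ allFin k ] 𝟙 (¬? (lookup c v ≟ᶠ a)) * F (c [ v ]≔ a)

∑-diffCount≡1 : ∀ {m k} (c : Coloring m k) (F : Coloring m k → ℕ) →
                (∑[ d ∈ allColorings m k ] 𝟙 (diffCount c d ≟ 1) * F d) ≡
                (∑[ v ∈ allFin m ] recolorSum F c v)
∑-diffCount≡1 []                F = refl
∑-diffCount≡1 {suc m} {k} (x ∷ c) F = begin
  ∑[ d ∈ allColorings (suc m) k ] 𝟙 (diffCount (x ∷ c) d ≟ 1) * F d
    ≡⟨ ∑-allColorings-suc (λ d → 𝟙 (diffCount (x ∷ c) d ≟ 1) * F d) ⟩
  ∑[ e ∈ allColorings m k ] ∑[ a ∈ allFin k ] 𝟙 (diffCount (x ∷ c) (a ∷ e) ≟ 1) * F (a ∷ e)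
    ≡⟨ ∑-cong (allColorings m k) split-head ⟩
  ∑[ e ∈ allColorings m k ] (δ₀ e * recolorSum F (x ∷ e) zero + δ₁ e * F (x ∷ e))
    ≡⟨ ∑-distrib-+ (allColorings m k) _ _ ⟩
  (∑[ e ∈ allColorings m k ] δ₀ e * recolorSum F (x ∷ e) zero) +
  (∑[ e ∈ allColorings m k ] δ₁ e * F (x ∷ e))
    ≡⟨ cong₂ _+_ (∑-diffCount≡0 c (λ e → recolorSum F (x ∷ e) zero))
                 (∑-diffCount≡1 c (λ e → F (x ∷ e))) ⟩
  recolorSum F (x ∷ c) zero + (∑[ v ∈ allFin m ] recolorSum F (x ∷ c) (suc v))
    ≡⟨ ∑-allFin-suc (recolorSum F (x ∷ c)) ⟨
  ∑[ v ∈ allFin (suc m) ] recolorSum F (x ∷ c) v ∎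
  where
  open ≡-Reasoning
  δ₀ δ₁ : Coloring m k → ℕ
  δ₀ e = 𝟙 (diffCount c e ≟ 0)
  δ₁ e = 𝟙 (diffCount c e ≟ 1)

  open +-*-Solver
  distribute : ∀ p q r s t → (p * q + r * s) * t ≡ q * (p * t) + s * (r * t)
  distribute = solve 5 (λ p q r s t → (p :* q :+ r :* s) :* t := q :* (p :* t) :+ s :* (r :* t)) refl

  split-case : ∀ e a → 𝟙 (diffCount (x ∷ c) (a ∷ e) ≟ 1) * F (a ∷ e) ≡
                       δ₀ e * (𝟙 (¬? (x ≟ᶠ a)) * F (a ∷ e)) +
                       δ₁ e * (𝟙 (x ≟ᶠ a) * F (a ∷ e))
  split-case e a =
    trans (cong (_* F (a ∷ e)) (𝟙-diffCount-∷≡1 x a c e))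
          (distribute (𝟙 (¬? (x ≟ᶠ a))) (δ₀ e) (𝟙 (x ≟ᶠ a)) (δ₁ e) (F (a ∷ e)))

  split-head : ∀ e → (∑[ a ∈ allFin k ] 𝟙 (diffCount (x ∷ c) (a ∷ e) ≟ 1) * F (a ∷ e)) ≡
                     δ₀ e * recolorSum F (x ∷ e) zero + δ₁ e * F (x ∷ e)
  split-head e = begin
    ∑[ a ∈ allFin k ] 𝟙 (diffCount (x ∷ c) (a ∷ e) ≟ 1) * F (a ∷ e)
      ≡⟨ ∑-cong (allFin k) (split-case e) ⟩
    ∑[ a ∈ allFin k ] (δ₀ e * (𝟙 (¬? (x ≟ᶠ a)) * F (a ∷ e)) +
                       δ₁ e * (𝟙 (x ≟ᶠ a) * F (a ∷ e)))
      ≡⟨ ∑-distrib-+ (allFin k) _ _ ⟩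
    (∑[ a ∈ allFin k ] δ₀ e * (𝟙 (¬? (x ≟ᶠ a)) * F (a ∷ e))) +
    (∑[ a ∈ allFin k ] δ₁ e * (𝟙 (x ≟ᶠ a) * F (a ∷ e)))
      ≡⟨ cong₂ _+_ (*-distribˡ-∑ (δ₀ e) (allFin k) _) (*-distribˡ-∑ (δ₁ e) (allFin k) _) ⟨
    δ₀ e * recolorSum F (x ∷ e) zero + δ₁ e * (∑[ a ∈ allFin k ] 𝟙 (x ≟ᶠ a) * F (a ∷ e))
      ≡⟨ cong (δ₀ e * recolorSum F (x ∷ e) zero +_)
              (cong (δ₁ e *_) (∑-allFin-δ x (λ a → F (a ∷ e)))) ⟩
    δ₀ e * recolorSum F (x ∷ e) zero + δ₁ e * F (x ∷ e) ∎

∑-pairs : {A : Set} (r : A → A → ℕ) → (∀ x y → r x y ≡ r y x) → (∀ x → r x x ≡ 0) →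
          (xs : List A) → 2 * ∑ (pairs xs) (uncurry r) ≡ (∑[ x ∈ xs ] ∑[ y ∈ xs ] r x y)
∑-pairs r r-sym r-diag []       = refl
∑-pairs r r-sym r-diag (x ∷ xs) = begin
  2 * ∑ (map (x ,_) xs ++ pairs xs) (uncurry r)
    ≡⟨ cong (2 *_) (trans (∑-++ (map (x ,_) xs) (pairs xs) (uncurry r))
                          (cong (_+ P) (∑-map (x ,_) xs (uncurry r)))) ⟩
  2 * (R + P)
    ≡⟨ double-+ R P ⟩
  R + (R + 2 * P)
    ≡⟨ cong₂ (λ s t → s + (t + 2 * P)) (cong (_+ R) (r-diag x))
                                       (∑-cong xs (λ y → r-sym y x)) ⟨
  (r x x + R) + ((∑[ y ∈ xs ] r y x) + 2 * P)
    ≡⟨ cong (λ t → (r x x + R) + ((∑[ y ∈ xs ] r y x) + t)) (∑-pairs r r-sym r-diag xs) ⟩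
  (r x x + R) + ((∑[ y ∈ xs ] r y x) + (∑[ y ∈ xs ] ∑[ z ∈ xs ] r y z))
    ≡⟨ cong ((r x x + R) +_) (∑-distrib-+ xs (λ y → r y x) (λ y → ∑ xs (r y))) ⟨
  (∑[ y ∈ x ∷ xs ] ∑[ z ∈ x ∷ xs ] r y z) ∎
  where
  open ≡-Reasoning
  R P : ℕ
  R = ∑ xs (r x)
  P = ∑ (pairs xs) (uncurry r)

  open +-*-Solver
  double-+ : ∀ a b → 2 * (a + b) ≡ a + (a + 2 * b)
  double-+ = solve 2 (λ a b → con 2 :* (a :+ b) := a :+ (a :+ con 2 :* b)) refl

module _ {n} (G : SimpleGraph n) (v : Fin n) where

  splitAdj-twin : splitAdj G v zero (suc v) ≡ true
  splitAdj-twin = cong (_∨ adj G v v) (dec-true (v ≟ᶠ v) refl)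

  splitAdj-neighbour : ∀ {j} → adj G v j ≡ true → splitAdj G v zero (suc j) ≡ true
  splitAdj-neighbour {j} vj = trans (cong (does (j ≟ᶠ v) ∨_) vj) (∨-zeroʳ (does (j ≟ᶠ v)))

  module _ {k} (a : Fin k) (c : Coloring n k) where

    recoloring-proper : Proper (split G v) (a ∷ c) → Proper G (c [ v ]≔ a)
    recoloring-proper h i j ij with i ≟ᶠ v | j ≟ᶠ v
    ... | yes refl | yes refl = contradiction (trans (sym (irrfl G i)) ij) λ ()
    ... | yes refl | no j≢v rewrite lookup∘update i c a | lookup∘update′ j≢v c a =
      h zero (suc j) (splitAdj-neighbour ij)
    ... | no i≢v | yes refl rewrite lookup∘update j c a | lookup∘update′ i≢v c a =
      h (suc i) zero (splitAdj-neighbour (trans (adj-sym G j i) ij))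
    ... | no i≢v | no j≢v rewrite lookup∘update′ i≢v c a | lookup∘update′ j≢v c a =
      h (suc i) (suc j) ij

    proper-split : Proper G c → lookup c v ≢ a → Proper G (c [ v ]≔ a) →
                   Proper (split G v) (a ∷ c)
    proper-split pc cv≢a pu zero    zero    ()
    proper-split pc cv≢a pu zero    (suc j) e with j ≟ᶠ v
    ... | yes refl = cv≢a ∘ sym
    ... | no j≢v   = subst₂ _≢_ (lookup∘update v c a) (lookup∘update′ j≢v c a) (pu v j e)
    proper-split pc cv≢a pu (suc i) zero    e with i ≟ᶠ v
    ... | yes refl = cv≢a
    ... | no i≢v   = subst₂ _≢_ (lookup∘update v c a) (lookup∘update′ i≢v c a) (pu v i e) ∘ sym
    proper-split pc cv≢a pu (suc i) (suc j) e = pc i j e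

    proper-split⇔ : Proper (split G v) (a ∷ c) ⇔
                    (Proper G c × lookup c v ≢ a × Proper G (c [ v ]≔ a))
    proper-split⇔ = mk⇔
      (λ h → (λ i j → h (suc i) (suc j))
           , (λ cv≡a → h zero (suc v) splitAdj-twin (sym cv≡a))
           , recoloring-proper h)
      (λ (pc , cv≢a , pu) → proper-split pc cv≢a pu)

    𝟙-proper-split : 𝟙 (proper? (split G v) (a ∷ c)) ≡
                     𝟙 (proper? G c) * (𝟙 (¬? (lookup c v ≟ᶠ a)) * 𝟙 (proper? G (c [ v ]≔ a)))
    𝟙-proper-split = begin
      𝟙 (proper? (split G v) (a ∷ c))
        ≡⟨ 𝟙-⇔ proper-split⇔ (proper? (split G v) (a ∷ c)) (pc? ×-dec cv≢a? ×-dec pu?) ⟩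
      𝟙 (pc? ×-dec cv≢a? ×-dec pu?)
        ≡⟨ 𝟙-×-dec pc? (cv≢a? ×-dec pu?) ⟩
      𝟙 pc? * 𝟙 (cv≢a? ×-dec pu?)
        ≡⟨ cong (𝟙 pc? *_) (𝟙-×-dec cv≢a? pu?) ⟩
      𝟙 pc? * (𝟙 cv≢a? * 𝟙 pu?) ∎
      where
      open ≡-Reasoning
      pc? : Dec (Proper G c)
      pc? = proper? G c
      cv≢a? : Dec (lookup c v ≢ a)
      cv≢a? = ¬? (lookup c v ≟ᶠ a)
      pu? : Dec (Proper G (c [ v ]≔ a))
      pu? = proper? G (c [ v ]≔ a)

recolorings : ∀ {n k} → SimpleGraph n → Coloring n k → Fin n → ℕ
recolorings G = recolorSum (λ d → 𝟙 (proper? G d))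

π-split : ∀ {n} (G : SimpleGraph n) (v : Fin n) (k : ℕ) →
          π (split G v) k ≡ (∑[ c ∈ allColorings n k ] 𝟙 (proper? G c) * recolorings G c v)
π-split {n} G v k = begin
  π (split G v) k
    ≡⟨ length-filter≡∑𝟙 (proper? (split G v)) (allColorings (suc n) k) ⟩
  ∑[ d ∈ allColorings (suc n) k ] 𝟙 (proper? (split G v) d)
    ≡⟨ ∑-allColorings-suc (λ d → 𝟙 (proper? (split G v) d)) ⟩
  ∑[ c ∈ allColorings n k ] ∑[ a ∈ allFin k ] 𝟙 (proper? (split G v) (a ∷ c))
    ≡⟨ ∑-cong (allColorings n k) (λ c → ∑-cong (allFin k) (λ a → 𝟙-proper-split G v a c)) ⟩
  ∑[ c ∈ allColorings n k ] ∑[ a ∈ allFin k ] 𝟙 (proper? G c) * recolored c a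
    ≡⟨ ∑-cong (allColorings n k) (λ c → *-distribˡ-∑ (𝟙 (proper? G c)) (allFin k) _) ⟨
  ∑[ c ∈ allColorings n k ] 𝟙 (proper? G c) * recolorings G c v ∎
  where
  open ≡-Reasoning
  recolored : Coloring n k → Fin k → ℕ
  recolored c a = 𝟙 (¬? (lookup c v ≟ᶠ a)) * 𝟙 (proper? G (c [ v ]≔ a))

degree≡∑-recolorings : ∀ {n} (G : SimpleGraph n) (k : ℕ) (c : Coloring n k) →
  (∑[ d ∈ properColorings G k ] 𝟙 (diffCount c d ≟ 1)) ≡ (∑[ v ∈ allFin n ] recolorings G c v)
degree≡∑-recolorings {n} G k c = begin
  ∑[ d ∈ properColorings G k ] 𝟙 (diffCount c d ≟ 1)
    ≡⟨ ∑-filter (proper? G) (allColorings n k) (λ d → 𝟙 (diffCount c d ≟ 1)) ⟩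
  ∑[ d ∈ allColorings n k ] 𝟙 (proper? G d) * 𝟙 (diffCount c d ≟ 1)
    ≡⟨ ∑-cong (allColorings n k) (λ d → *-comm (𝟙 (proper? G d)) _) ⟩
  ∑[ d ∈ allColorings n k ] 𝟙 (diffCount c d ≟ 1) * 𝟙 (proper? G d)
    ≡⟨ ∑-diffCount≡1 c (λ d → 𝟙 (proper? G d)) ⟩
  ∑[ v ∈ allFin n ] recolorings G c v ∎
  where open ≡-Reasoning

handshake : ∀ {n} (G : SimpleGraph n) (k : ℕ) →
  2 * πP₂ G k ≡
  (∑[ c ∈ allColorings n k ] 𝟙 (proper? G c) * (∑[ v ∈ allFin n ] recolorings G c v))
handshake {n} G k = begin
  2 * πP₂ G k
    ≡⟨ cong (2 *_) (length-filter≡∑𝟙 CAdj? (pairs P)) ⟩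
  2 * ∑ (pairs P) (uncurry adjacent)
    ≡⟨ ∑-pairs adjacent (λ c d → cong (λ m → 𝟙 (m ≟ 1)) (diffCount-sym c d))
                        (λ c → cong (λ m → 𝟙 (m ≟ 1)) (diffCount-self c)) P ⟩
  ∑[ c ∈ P ] ∑[ d ∈ P ] adjacent c d
    ≡⟨ ∑-filter (proper? G) (allColorings n k) (λ c → ∑[ d ∈ P ] adjacent c d) ⟩
  ∑[ c ∈ allColorings n k ] 𝟙 (proper? G c) * (∑[ d ∈ P ] adjacent c d)
    ≡⟨ ∑-cong (allColorings n k)
              (λ c → cong (𝟙 (proper? G c) *_) (degree≡∑-recolorings G k c)) ⟩
  ∑[ c ∈ allColorings n k ] 𝟙 (proper? G c) * (∑[ v ∈ allFin n ] recolorings G c v) ∎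
  where
  open ≡-Reasoning
  P : List (Coloring n k)
  P = properColorings G k
  adjacent : Coloring n k → Coloring n k → ℕ
  adjacent c d = 𝟙 (diffCount c d ≟ 1)

-- The identity also holds for k = 0.
lemma2p2 : ∀ {n} (G : SimpleGraph n) (k : ℕ) → 1 ≤ k →
    2 * πP₂ G k ≡ sum (map (λ v → π (split G v) k) (allFin n))
lemma2p2 {n} G k _ = begin
  2 * πP₂ G k
    ≡⟨ handshake G k ⟩
  ∑[ c ∈ allColorings n k ] 𝟙 (proper? G c) * (∑[ v ∈ allFin n ] recolorings G c v)
    ≡⟨ ∑-cong (allColorings n k) (λ c → *-distribˡ-∑ (𝟙 (proper? G c)) (allFin n) _) ⟩
  ∑[ c ∈ allColorings n k ] ∑[ v ∈ allFin n ] 𝟙 (proper? G c) * recolorings G c v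
    ≡⟨ ∑-comm (allColorings n k) (allFin n) (λ c v → 𝟙 (proper? G c) * recolorings G c v) ⟩
  ∑[ v ∈ allFin n ] ∑[ c ∈ allColorings n k ] 𝟙 (proper? G c) * recolorings G c v
    ≡⟨ ∑-cong (allFin n) (λ v → π-split G v k) ⟨
  sum (map (λ v → π (split G v) k) (allFin n)) ∎
  where open ≡-Reasoning
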